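{- Let $n\ge3$ and $A=[a_{ij}],B=[b_{ij}]\in\mathcal{PC}_n^0$. If $\tau\in\Gamma(A)$, $\nu\in\Gamma(B)$ and $P_{A,\tau}=P_{B,\nu}$, then $\tau=\nu$. Moreover, the sequences of entries of $A$ and of $B$ along $\tau$ ($=\nu$) coincide, i.e. writing $\tau=\tau_1\cdots\tau_n\tau_1$, $a_{\tau_t\tau_{t+1}}=b_{\tau_t\tau_{t+1}}$ for $t=1,\dots,n-1$ and $a_{\tau_n\tau_1}=b_{\tau_n\tau_1}$. In particular, $\tau(A)=\nu(B)$.
   Context: Let $N=\{1,\dots,n\}$. A matrix $A=[a_{ij}]$ is reciprocal if its entries are positive and $a_{ji}=1/a_{ij}$; $\mathcal{PC}_n$ is the set of $n\times n$ reciprocal matrices; $A$ is consistent if $a_{ij}a_{jk}=a_{ik}$ for all $i,j,k$; $\mathcal{PC}_n^0$ is the set of non-consistent matrices in $\mathcal{PC}_n$. A Hamiltonian cycle (H-cycle) in $N$ is a cyclic sequence $\tau=\tau_1\cdots\tau_n\tau_1$ with $\tau_1\cdots\tau_n$ a permutation of $N$; it may be listed starting at any index (cyclic shifts give the same H-cycle), while the reversed sequence is a different H-cycle. $\tau(A)=a_{\tau_1\tau_2}\cdots a_{\tau_{n-1}\tau_n}a_{\tau_n\tau_1}$; $\Gamma(A)$ is the set of H-cycles with $\tau(A)<1$. For $i\ne j$, listing $\tau$ with $\tau_1=i$ and $\tau_k=j$, $P_{A,\tau}(i,j)=a_{\tau_1\tau_2}\cdots a_{\tau_{k-1}\tau_k}$;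 the path matrix $P_{A,\tau}$ has diagonal entries $1$ and $(i,j)$ entry $P_{A,\tau}(i,j)$ for $i\ne j$. -}

module Defs where

open import Level using (Level; _⊔_) renaming (suc to lsuc)
open import Algebra.Bundles using (AbelianGroup)
open import Relation.Binary.Core using (Rel)
open import Relation.Binary.Structures using (IsStrictTotalOrder)
open import Data.Nat using (ℕ; zero; suc; _+_; _∸_; _%_)
open import Data.Nat.DivMod using (m%n<n)
open import Data.Fin using (Fin; toℕ; fromℕ<)
open import Data.Fin.Permutation using (Permutation′; _⟨$⟩ʳ_; _⟨$⟩ˡ_)
open import Data.Product using (Σ; _×_)
open import Relation.Binary.PropositionalEquality using (_≡_)
open import Relation.Nullary using (¬_)

-- The positive reals (ℝ_{>0}, ·, 1, ⁻¹, <) are the intended instance: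
-- entries of reciprocal matrices live here (positivity is built in).
record OrderedAbelianGroup c ℓ₁ ℓ₂ : Set (lsuc (c ⊔ ℓ₁ ⊔ ℓ₂)) where
  field
    abelianGroup : AbelianGroup c ℓ₁
  open AbelianGroup abelianGroup public
  field
    _<_                : Rel Carrier ℓ₂
    isStrictTotalOrder : IsStrictTotalOrder _≈_ _<_
    <-compat           : ∀ {x y} z → x < y → (x ∙ z) < (y ∙ z)

sucMod : ∀ {n} → Fin n → Fin n
sucMod {suc m} t = fromℕ< (m%n<n (suc (toℕ t)) (suc m))

shiftMod : ∀ {n} → Fin n → Fin n → Fin n
shiftMod {suc m} s t = fromℕ< (m%n<n (toℕ t + toℕ s) (suc m))

dist : ∀ {n} → Fin n → Fin n → ℕ
dist {suc m} p q = ((toℕ q + suc m) ∸ toℕ p) % suc m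

-- An H-cycle τ = τ₁⋯τₙτ₁ is given by the sequence τ₁⋯τₙ, i.e. a
-- permutation of Fin n (position t ↦ vertex τ ⟨$⟩ʳ t).
HSeq : ℕ → Set
HSeq n = Permutation′ n

-- Two sequences describe the same H-cycle iff one is a cyclic shift
-- of the other (reversal is NOT identified).
SameHCycle : ∀ {n} → HSeq n → HSeq n → Set
SameHCycle {n} τ ν = Σ (Fin n) λ s → ∀ t → ν ⟨$⟩ʳ shiftMod s t ≡ τ ⟨$⟩ʳ t

module PC {c ℓ₁ ℓ₂} (G : OrderedAbelianGroup c ℓ₁ ℓ₂) where
  open OrderedAbelianGroup G

  Matrix : ℕ → Set c
  Matrix n = Fin n → Fin n → Carrier

  Reciprocal : ∀ {n} → Matrix n → Set ℓ₁
  Reciprocal A = ∀ i j → A j i ≈ (A i j) ⁻¹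

  Consistent : ∀ {n} → Matrix n → Set ℓ₁
  Consistent A = ∀ i j k → (A i j ∙ A j k) ≈ A i k

  InPC⁰ : ∀ {n} → Matrix n → Set ℓ₁
  InPC⁰ A = Reciprocal A × ¬ Consistent A

  prod : ∀ {n} → (Fin n → Carrier) → Carrier
  prod {zero}  f = ε
  prod {suc n} f = f Fin.zero ∙ prod (λ t → f (Fin.suc t))

  edge : ∀ {n} → Matrix n → HSeq n → Fin n → Carrier
  edge A τ t = A (τ ⟨$⟩ʳ t) (τ ⟨$⟩ʳ sucMod t)

  cycVal : ∀ {n} → Matrix n → HSeq n → Carrier
  cycVal A τ = prod (edge A τ)

  InΓ : ∀ {n} → Matrix n → HSeq n → Set ℓ₂
  InΓ A τ = cycVal A τ < ε

  walk : ∀ {n} → Matrix n → HSeq n → ℕ → Fin n → Carrier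
  walk A τ zero    p = ε
  walk A τ (suc k) p = edge A τ p ∙ walk A τ k (sucMod p)

  -- path matrix P_{A,τ}: (i,j) entry is the product of the entries of A
  -- along τ from i to j; diagonal entries are 1 (zero steps).
  pathMatrix : ∀ {n} → Matrix n → HSeq n → Matrix n
  pathMatrix A τ i j = walk A τ (dist (τ ⟨$⟩ˡ i) (τ ⟨$⟩ˡ j)) (τ ⟨$⟩ˡ i)

-- The path matrix P = P_{M,σ} sees the cycle locally: for j ≠ i, P i j = P i (next i) ∙ P (next i) j
-- and P i (next i) is the entry of M on that edge, while P i j ∙ P j i = σ(M) for i ≠ j.  If τ and
-- ν, with P_{A,τ} = P_{B,ν}, sent a vertex i to different successors j ≠ j′, splitting P i j′ at j
-- and P i j at j′ would give P i j = P i j ∙ τ(A), so τ(A) = 1, contradicting τ ∈ Γ(A).  Hence τ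
-- and ν have the same successor map, so they are the same H-cycle; the edge entries are read off the
-- common path matrix, and τ(A) = P 0 1 ∙ P 1 0 = ν(B).
module Submission where

open import Defs
open import Data.Nat using (ℕ; _≤_)
open import Data.Product using (_×_)
open import Data.Nat using (NonZero; zero; suc; _+_; _∸_; _%_; _<_; _<?_; s≤s; z≤n)
open import Data.Nat.Properties
open import Data.Nat.DivMod using (m<n⇒m%n≡m; [m+n]%n≡m%n; n%n≡0; %-distribˡ-+; m%n%n≡m%n)
open import Data.Nat.GeneralisedArithmetic using (iterate)
open import Data.Fin as Fin using (Fin; toℕ)
open import Data.Fin.Properties using (toℕ-injective; toℕ-fromℕ<; toℕ<n)
open import Data.Fin.Permutation using (_⟨$⟩ʳ_; _⟨$⟩ˡ_; inverseˡ; inverseʳ)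
open import Data.Product using (_,_)
open import Data.Sum using (_⊎_; inj₁; inj₂)
open import Data.Empty using (⊥-elim)
open import Function using (_∘_)
open import Relation.Nullary using (¬_; yes; no)
open import Relation.Binary.Definitions using (tri<; tri≈; tri>)
open import Relation.Binary.Structures using (IsStrictTotalOrder)
open import Relation.Binary.PropositionalEquality
  using (_≡_; _≢_; refl; sym; trans; cong; cong₂; subst; module ≡-Reasoning)

∸-suc : ∀ {a x} → a < x → x ∸ a ≡ suc (x ∸ suc a)
∸-suc {a} {suc x} a<x = +-∸-assoc 1 (≤-pred a<x)

∸+∸ : ∀ {a b c} → a ≤ b → b ≤ c → (b ∸ a) + (c ∸ b) ≡ c ∸ a
∸+∸ {a} {b} {c} a≤b b≤c = begin
  (b ∸ a) + (c ∸ b)  ≡⟨ +-comm (b ∸ a) (c ∸ b) ⟩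
  (c ∸ b) + (b ∸ a)  ≡⟨ +-∸-assoc (c ∸ b) a≤b ⟨
  (c ∸ b) + b ∸ a    ≡⟨ cong (_∸ a) (m∸n+n≡m b≤c) ⟩
  c ∸ a              ∎
  where open ≡-Reasoning

[m%n+k]%n≡[m+k]%n : ∀ m k n .{{_ : NonZero n}} → (m % n + k) % n ≡ (m + k) % n
[m%n+k]%n≡[m+k]%n m k n = begin
  (m % n + k) % n          ≡⟨ %-distribˡ-+ (m % n) k n ⟩
  (m % n % n + k % n) % n  ≡⟨ cong (λ x → (x + k % n) % n) (m%n%n≡m%n m n) ⟩
  (m % n + k % n) % n      ≡⟨ %-distribˡ-+ m k n ⟨
  (m + k) % n              ∎
  where open ≡-Reasoning

[m+k%n]%n≡[m+k]%n : ∀ m k n .{{_ : NonZero n}} → (m + k % n) % n ≡ (m + k) % n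
[m+k%n]%n≡[m+k]%n m k n = begin
  (m + k % n) % n          ≡⟨ cong (_% n) (+-comm m (k % n)) ⟩
  (k % n + m) % n          ≡⟨ [m%n+k]%n≡[m+k]%n k m n ⟩
  (k + m) % n              ≡⟨ cong (_% n) (+-comm k m) ⟩
  (m + k) % n              ∎
  where open ≡-Reasoning

module _ {m : ℕ} where

  toℕ-sucMod : (p : Fin (suc m)) → toℕ (sucMod p) ≡ suc (toℕ p) % suc m
  toℕ-sucMod p = toℕ-fromℕ< _

  toℕ-iterate-sucMod : ∀ (p : Fin (suc m)) d → toℕ (iterate sucMod p d) ≡ (toℕ p + d) % suc m
  toℕ-iterate-sucMod p zero = sym (trans (cong (_% suc m) (+-identityʳ (toℕ p))) (m<n⇒m%n≡m (toℕ<n p)))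
  toℕ-iterate-sucMod p (suc d) = begin
    toℕ (iterate sucMod (sucMod p) d)      ≡⟨ toℕ-iterate-sucMod (sucMod p) d ⟩
    (toℕ (sucMod p) + d) % suc m           ≡⟨ cong (λ x → (x + d) % suc m) (toℕ-sucMod p) ⟩
    (suc (toℕ p) % suc m + d) % suc m      ≡⟨ [m%n+k]%n≡[m+k]%n (suc (toℕ p)) d (suc m) ⟩
    (suc (toℕ p) + d) % suc m              ≡⟨ cong (_% suc m) (sym (+-suc (toℕ p) d)) ⟩
    (toℕ p + suc d) % suc m                ∎
    where open ≡-Reasoning

  sucMod-cases : (p : Fin (suc m)) →
                 (toℕ p < m × toℕ (sucMod p) ≡ suc (toℕ p)) ⊎ (toℕ p ≡ m × toℕ (sucMod p) ≡ 0)
  sucMod-cases p with toℕ p <? m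
  ... | yes p<m = inj₁ (p<m , trans (toℕ-sucMod p) (m<n⇒m%n≡m (s≤s p<m)))
  ... | no p≮m  = inj₂ (p≡m , trans (toℕ-sucMod p) (trans (cong (λ x → suc x % suc m) p≡m) (n%n≡0 (suc m))))
    where p≡m : toℕ p ≡ m
          p≡m = ≤-antisym (≤-pred (toℕ<n p)) (≮⇒≥ p≮m)

  dist-≤ : {p q : Fin (suc m)} → toℕ p ≤ toℕ q → dist p q ≡ toℕ q ∸ toℕ p
  dist-≤ {p} {q} p≤q = begin
    (toℕ q + suc m ∸ toℕ p) % suc m    ≡⟨ cong (_% suc m) (+-∸-comm (suc m) p≤q) ⟩
    (toℕ q ∸ toℕ p + suc m) % suc m    ≡⟨ [m+n]%n≡m%n (toℕ q ∸ toℕ p) (suc m) ⟩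
    (toℕ q ∸ toℕ p) % suc m            ≡⟨ m<n⇒m%n≡m (≤-<-trans (m∸n≤m (toℕ q) (toℕ p)) (toℕ<n q)) ⟩
    toℕ q ∸ toℕ p                      ∎
    where open ≡-Reasoning

  dist-> : {p q : Fin (suc m)} → toℕ q < toℕ p → dist p q ≡ toℕ q + suc m ∸ toℕ p
  dist-> {p} {q} q<p = m<n⇒m%n≡m (m<n+o⇒m∸n<o (toℕ q + suc m) (toℕ p) (+-monoˡ-< (suc m) q<p))

  dist-refl : (p : Fin (suc m)) → dist p p ≡ 0
  dist-refl p = trans (dist-≤ {p} {p} ≤-refl) (n∸n≡0 (toℕ p))

  iterate-sucMod-dist : (p q : Fin (suc m)) → iterate sucMod p (dist p q) ≡ q
  iterate-sucMod-dist p q = toℕ-injective (begin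
    toℕ (iterate sucMod p (dist p q))             ≡⟨ toℕ-iterate-sucMod p (dist p q) ⟩
    (toℕ p + dist p q) % suc m                    ≡⟨ [m+k%n]%n≡[m+k]%n (toℕ p) (toℕ q + suc m ∸ toℕ p) (suc m) ⟩
    (toℕ p + (toℕ q + suc m ∸ toℕ p)) % suc m     ≡⟨ cong (_% suc m) (m+[n∸m]≡n p≤q+n) ⟩
    (toℕ q + suc m) % suc m                       ≡⟨ [m+n]%n≡m%n (toℕ q) (suc m) ⟩
    toℕ q % suc m                                 ≡⟨ m<n⇒m%n≡m (toℕ<n q) ⟩
    toℕ q                                         ∎)
    where open ≡-Reasoning
          p≤q+n : toℕ p ≤ toℕ q + suc m
          p≤q+n = ≤-trans (<⇒≤ (toℕ<n p)) (m≤n+m (suc m) (toℕ q))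

  dist-sucMod : {p q : Fin (suc m)} → q ≢ p → dist p q ≡ suc (dist (sucMod p) q)
  dist-sucMod {p} {q} q≢p with sucMod-cases p
  ... | inj₂ (p≡m , p′≡0) = begin
    dist p q                            ≡⟨ dist-> q<p ⟩
    toℕ q + suc m ∸ toℕ p               ≡⟨ cong₂ _∸_ (+-suc (toℕ q) m) p≡m ⟩
    suc (toℕ q) + m ∸ m                 ≡⟨ m+n∸n≡m (suc (toℕ q)) m ⟩
    suc (toℕ q)                         ≡⟨ cong (λ x → suc (toℕ q ∸ x)) p′≡0 ⟨
    suc (toℕ q ∸ toℕ (sucMod p))        ≡⟨ cong suc (dist-≤ (subst (_≤ toℕ q) (sym p′≡0) z≤n)) ⟨
    suc (dist (sucMod p) q)             ∎
    where open ≡-Reasoning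
          q<p : toℕ q < toℕ p
          q<p = subst (toℕ q <_) (sym p≡m)
                  (≤∧≢⇒< (≤-pred (toℕ<n q)) (λ q≡m → q≢p (toℕ-injective (trans q≡m (sym p≡m)))))
  ... | inj₁ (p<m , p′≡1+p) with <-cmp (toℕ p) (toℕ q)
  ...   | tri≈ _ p≡q _ = ⊥-elim (q≢p (toℕ-injective (sym p≡q)))
  ...   | tri< p<q _ _ = begin
    dist p q                            ≡⟨ dist-≤ (<⇒≤ p<q) ⟩
    toℕ q ∸ toℕ p                       ≡⟨ ∸-suc p<q ⟩
    suc (toℕ q ∸ suc (toℕ p))           ≡⟨ cong (λ x → suc (toℕ q ∸ x)) p′≡1+p ⟨
    suc (toℕ q ∸ toℕ (sucMod p))        ≡⟨ cong suc (dist-≤ (subst (_≤ toℕ q) (sym p′≡1+p) p<q)) ⟨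
    suc (dist (sucMod p) q)             ∎
    where open ≡-Reasoning
  ...   | tri> _ _ q<p = begin
    dist p q                            ≡⟨ dist-> q<p ⟩
    toℕ q + suc m ∸ toℕ p               ≡⟨ ∸-suc p<q+n ⟩
    suc (toℕ q + suc m ∸ suc (toℕ p))   ≡⟨ cong (λ x → suc (toℕ q + suc m ∸ x)) p′≡1+p ⟨
    suc (toℕ q + suc m ∸ toℕ (sucMod p)) ≡⟨ cong suc (dist-> (subst (toℕ q <_) (sym p′≡1+p) (m<n⇒m<1+n q<p))) ⟨
    suc (dist (sucMod p) q)             ∎
    where open ≡-Reasoning
          p<q+n : toℕ p < toℕ q + suc m
          p<q+n = <-≤-trans (toℕ<n p) (m≤n+m (suc m) (toℕ q))

  dist+dist-< : {p q : Fin (suc m)} → toℕ p < toℕ q → dist p q + dist q p ≡ suc m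
  dist+dist-< {p} {q} p<q = begin
    dist p q + dist q p                        ≡⟨ cong₂ _+_ (dist-≤ (<⇒≤ p<q)) (dist-> p<q) ⟩
    (toℕ q ∸ toℕ p) + (toℕ p + suc m ∸ toℕ q)  ≡⟨ ∸+∸ (<⇒≤ p<q) (≤-trans (<⇒≤ (toℕ<n q)) (m≤n+m (suc m) (toℕ p))) ⟩
    toℕ p + suc m ∸ toℕ p                      ≡⟨ m+n∸m≡n (toℕ p) (suc m) ⟩
    suc m                                      ∎
    where open ≡-Reasoning

  dist+dist : {p q : Fin (suc m)} → p ≢ q → dist p q + dist q p ≡ suc m
  dist+dist {p} {q} p≢q with <-cmp (toℕ p) (toℕ q)
  ... | tri< p<q _ _ = dist+dist-< p<q
  ... | tri≈ _ p≡q _ = ⊥-elim (p≢q (toℕ-injective p≡q))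
  ... | tri> _ _ q<p = trans (+-comm (dist p q) (dist q p)) (dist+dist-< q<p)

  iterate-sucMod-toℕ : (p : Fin (suc m)) → iterate sucMod Fin.zero (toℕ p) ≡ p
  iterate-sucMod-toℕ p = toℕ-injective (trans (toℕ-iterate-sucMod Fin.zero (toℕ p)) (m<n⇒m%n≡m (toℕ<n p)))

  iterate-sucMod-period : (p : Fin (suc m)) → iterate sucMod p (suc m) ≡ p
  iterate-sucMod-period p = toℕ-injective (begin
    toℕ (iterate sucMod p (suc m))  ≡⟨ toℕ-iterate-sucMod p (suc m) ⟩
    (toℕ p + suc m) % suc m         ≡⟨ [m+n]%n≡m%n (toℕ p) (suc m) ⟩
    toℕ p % suc m                   ≡⟨ m<n⇒m%n≡m (toℕ<n p) ⟩
    toℕ p                           ∎)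
    where open ≡-Reasoning

  shiftMod≡iterate : (s t : Fin (suc m)) → shiftMod s t ≡ iterate sucMod s (toℕ t)
  shiftMod≡iterate s t = toℕ-injective (begin
    toℕ (shiftMod s t)                 ≡⟨ toℕ-fromℕ< _ ⟩
    (toℕ t + toℕ s) % suc m            ≡⟨ cong (_% suc m) (+-comm (toℕ t) (toℕ s)) ⟩
    (toℕ s + toℕ t) % suc m            ≡⟨ toℕ-iterate-sucMod s (toℕ t) ⟨
    toℕ (iterate sucMod s (toℕ t))     ∎)
    where open ≡-Reasoning

sucMod≢ : ∀ {k} (p : Fin (suc (suc k))) → sucMod p ≢ p
sucMod≢ p p′≡p with sucMod-cases p
... | inj₁ (_ , p′≡1+p) = 1+n≢n (trans (sym p′≡1+p) (cong toℕ p′≡p))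
... | inj₂ (p≡m , p′≡0) = 1+n≢0 (trans (sym p≡m) (trans (cong toℕ (sym p′≡p)) p′≡0))

module _ {m : ℕ} (σ : HSeq (suc m)) where

  next : Fin (suc m) → Fin (suc m)
  next i = σ ⟨$⟩ʳ sucMod (σ ⟨$⟩ˡ i)

  next-⟨$⟩ʳ : ∀ p → next (σ ⟨$⟩ʳ p) ≡ σ ⟨$⟩ʳ sucMod p
  next-⟨$⟩ʳ p = cong (λ x → σ ⟨$⟩ʳ sucMod x) (inverseˡ σ)

  ⟨$⟩ˡ-next : ∀ i → σ ⟨$⟩ˡ next i ≡ sucMod (σ ⟨$⟩ˡ i)
  ⟨$⟩ˡ-next i = inverseˡ σ

  ⟨$⟩ˡ-injective : ∀ {i j} → σ ⟨$⟩ˡ i ≡ σ ⟨$⟩ˡ j → i ≡ j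
  ⟨$⟩ˡ-injective eq = trans (sym (inverseʳ σ)) (trans (cong (σ ⟨$⟩ʳ_) eq) (inverseʳ σ))

next≢ : ∀ {k} (σ : HSeq (suc (suc k))) i → next σ i ≢ i
next≢ σ i next≡i = sucMod≢ (σ ⟨$⟩ˡ i) (trans (sym (⟨$⟩ˡ-next σ i)) (cong (σ ⟨$⟩ˡ_) next≡i))

next≡⇒SameHCycle : ∀ {m} (τ ν : HSeq (suc m)) → (∀ i → next τ i ≡ next ν i) → SameHCycle τ ν
next≡⇒SameHCycle τ ν next≡ = ν ⟨$⟩ˡ (τ ⟨$⟩ʳ Fin.zero) , λ t → begin
  ν ⟨$⟩ʳ shiftMod (ν ⟨$⟩ˡ (τ ⟨$⟩ʳ Fin.zero)) t                    ≡⟨ cong (ν ⟨$⟩ʳ_) (shiftMod≡iterate _ t) ⟩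
  ν ⟨$⟩ʳ iterate sucMod (ν ⟨$⟩ˡ (τ ⟨$⟩ʳ Fin.zero)) (toℕ t)        ≡⟨ follow (toℕ t) (inverseʳ ν) ⟩
  τ ⟨$⟩ʳ iterate sucMod Fin.zero (toℕ t)                          ≡⟨ cong (τ ⟨$⟩ʳ_) (iterate-sucMod-toℕ t) ⟩
  τ ⟨$⟩ʳ t                                                        ∎
  where
  open ≡-Reasoning
  follow : ∀ d {p q} → ν ⟨$⟩ʳ p ≡ τ ⟨$⟩ʳ q →
           ν ⟨$⟩ʳ iterate sucMod p d ≡ τ ⟨$⟩ʳ iterate sucMod q d
  follow zero    eq = eq
  follow (suc d) {p} {q} eq = follow d (begin
    ν ⟨$⟩ʳ sucMod p       ≡⟨ next-⟨$⟩ʳ ν p ⟨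
    next ν (ν ⟨$⟩ʳ p)     ≡⟨ cong (next ν) eq ⟩
    next ν (τ ⟨$⟩ʳ q)     ≡⟨ next≡ (τ ⟨$⟩ʳ q) ⟨
    next τ (τ ⟨$⟩ʳ q)     ≡⟨ next-⟨$⟩ʳ τ q ⟩
    τ ⟨$⟩ʳ sucMod q       ∎)

module _ {c ℓ₁ ℓ₂} (G : OrderedAbelianGroup c ℓ₁ ℓ₂) where
  open OrderedAbelianGroup G
    using (Carrier; _≈_; _∙_; ε; ∙-cong; ∙-congˡ; ∙-congʳ; assoc; comm; identityˡ; identityʳ; group; setoid)
    renaming (sym to ≈-sym; trans to ≈-trans)
  open PC G
  open import Algebra.Properties.Group group using (∙-cancelˡ; identityʳ-unique)
  open import Relation.Binary.Reasoning.Setoid setoid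

  module _ {m : ℕ} (M : Matrix (suc m)) (σ : HSeq (suc m)) where

    walk-+ : ∀ a b p → walk M σ (a + b) p ≈ walk M σ a p ∙ walk M σ b (iterate sucMod p a)
    walk-+ zero    b p = ≈-sym (identityˡ _)
    walk-+ (suc a) b p = begin
      edge M σ p ∙ walk M σ (a + b) (sucMod p)                                   ≈⟨ ∙-congˡ (walk-+ a b (sucMod p)) ⟩
      edge M σ p ∙ (walk M σ a (sucMod p) ∙ walk M σ b (iterate sucMod p (suc a))) ≈⟨ assoc _ _ _ ⟨
      walk M σ (suc a) p ∙ walk M σ b (iterate sucMod p (suc a))                 ∎

    prod≡walk : ∀ j p (f : Fin j → Carrier) →
                (∀ t → f t ≡ edge M σ (iterate sucMod p (toℕ t))) → prod f ≡ walk M σ j p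
    prod≡walk zero    p f f≡ = refl
    prod≡walk (suc j) p f f≡ =
      cong₂ _∙_ (f≡ Fin.zero) (prod≡walk j (sucMod p) (f ∘ Fin.suc) (f≡ ∘ Fin.suc))

    walk-rotate : ∀ k → walk M σ (suc m) (iterate sucMod Fin.zero k) ≈ walk M σ (suc m) Fin.zero
    walk-rotate k = ∙-cancelˡ (walk M σ k Fin.zero) _ _ (begin
      walk M σ k Fin.zero ∙ walk M σ (suc m) (iterate sucMod Fin.zero k)
        ≈⟨ walk-+ k (suc m) Fin.zero ⟨
      walk M σ (k + suc m) Fin.zero
        ≡⟨ cong (λ l → walk M σ l Fin.zero) (+-comm k (suc m)) ⟩
      walk M σ (suc m + k) Fin.zero
        ≈⟨ walk-+ (suc m) k Fin.zero ⟩
      walk M σ (suc m) Fin.zero ∙ walk M σ k (iterate sucMod Fin.zero (suc m))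
        ≡⟨ cong (λ p → walk M σ (suc m) Fin.zero ∙ walk M σ k p) (iterate-sucMod-period Fin.zero) ⟩
      walk M σ (suc m) Fin.zero ∙ walk M σ k Fin.zero
        ≈⟨ comm _ _ ⟩
      walk M σ k Fin.zero ∙ walk M σ (suc m) Fin.zero
        ∎)

    walk-period : ∀ p → walk M σ (suc m) p ≈ cycVal M σ
    walk-period p = begin
      walk M σ (suc m) p                                  ≡⟨ cong (walk M σ (suc m)) (iterate-sucMod-toℕ p) ⟨
      walk M σ (suc m) (iterate sucMod Fin.zero (toℕ p))  ≈⟨ walk-rotate (toℕ p) ⟩
      walk M σ (suc m) Fin.zero                           ≡⟨ prod≡walk (suc m) Fin.zero (edge M σ) edge≡ ⟨
      cycVal M σ                                          ∎
      where edge≡ : ∀ t → edge M σ t ≡ edge M σ (iterate sucMod Fin.zero (toℕ t))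
            edge≡ t = cong (edge M σ) (sym (iterate-sucMod-toℕ t))

    pathMatrix-diag : ∀ i → pathMatrix M σ i i ≡ ε
    pathMatrix-diag i = cong (λ d → walk M σ d (σ ⟨$⟩ˡ i)) (dist-refl (σ ⟨$⟩ˡ i))

    pathMatrix-next : ∀ {i j} → j ≢ i → pathMatrix M σ i j ≈ M i (next σ i) ∙ pathMatrix M σ (next σ i) j
    pathMatrix-next {i} {j} j≢i = begin
      walk M σ (dist p (σ ⟨$⟩ˡ j)) p
        ≡⟨ cong (λ d → walk M σ d p) (dist-sucMod (j≢i ∘ ⟨$⟩ˡ-injective σ)) ⟩
      edge M σ p ∙ walk M σ (dist (sucMod p) (σ ⟨$⟩ˡ j)) (sucMod p)
        ≡⟨ cong₂ _∙_ (cong (λ x → M x (next σ i)) (inverseʳ σ))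
                     (cong (λ x → walk M σ (dist x (σ ⟨$⟩ˡ j)) x) (sym (⟨$⟩ˡ-next σ i))) ⟩
      M i (next σ i) ∙ pathMatrix M σ (next σ i) j
        ∎
      where p : Fin (suc m)
            p = σ ⟨$⟩ˡ i

    pathMatrix-edge : ∀ i → next σ i ≢ i → pathMatrix M σ i (next σ i) ≈ M i (next σ i)
    pathMatrix-edge i next≢i = begin
      pathMatrix M σ i (next σ i)                              ≈⟨ pathMatrix-next next≢i ⟩
      M i (next σ i) ∙ pathMatrix M σ (next σ i) (next σ i)    ≡⟨ cong (M i (next σ i) ∙_) (pathMatrix-diag (next σ i)) ⟩
      M i (next σ i) ∙ ε                                       ≈⟨ identityʳ _ ⟩
      M i (next σ i)                                           ∎

    pathMatrix-cycle : ∀ {i j} → i ≢ j → pathMatrix M σ i j ∙ pathMatrix M σ j i ≈ cycVal M σ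
    pathMatrix-cycle {i} {j} i≢j = begin
      walk M σ (dist p q) p ∙ walk M σ (dist q p) q
        ≡⟨ cong (λ x → walk M σ (dist p q) p ∙ walk M σ (dist q p) x) (iterate-sucMod-dist p q) ⟨
      walk M σ (dist p q) p ∙ walk M σ (dist q p) (iterate sucMod p (dist p q))
        ≈⟨ walk-+ (dist p q) (dist q p) p ⟨
      walk M σ (dist p q + dist q p) p
        ≡⟨ cong (λ d → walk M σ d p) (dist+dist (i≢j ∘ ⟨$⟩ˡ-injective σ)) ⟩
      walk M σ (suc m) p
        ≈⟨ walk-period p ⟩
      cycVal M σ
        ∎
      where p q : Fin (suc m)
            p = σ ⟨$⟩ˡ i
            q = σ ⟨$⟩ˡ j

  pathMatrix-via-next : ∀ {k} (M : Matrix (suc (suc k))) (σ : HSeq (suc (suc k))) {i j} → j ≢ i →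
                        pathMatrix M σ i j ≈ pathMatrix M σ i (next σ i) ∙ pathMatrix M σ (next σ i) j
  pathMatrix-via-next M σ {i} j≢i =
    ≈-trans (pathMatrix-next M σ j≢i) (∙-congʳ (≈-sym (pathMatrix-edge M σ i (next≢ σ i))))

  module _ {k : ℕ} (A B : Matrix (suc (suc k))) (τ ν : HSeq (suc (suc k)))
           (P≈ : ∀ i j → pathMatrix A τ i j ≈ pathMatrix B ν i j) where

    pathMatrix≈⇒next≡ : ¬ (cycVal A τ ≈ ε) → ∀ i → next τ i ≡ next ν i
    pathMatrix≈⇒next≡ cyc≉ε i with next τ i Fin.≟ next ν i
    ... | yes j≡j′ = j≡j′
    ... | no  j≢j′ = ⊥-elim (cyc≉ε (identityʳ-unique (PA i j) (cycVal A τ) (begin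
      PA i j ∙ cycVal A τ             ≈⟨ ∙-congˡ (pathMatrix-cycle A τ j≢j′) ⟨
      PA i j ∙ (PA j j′ ∙ PA j′ j)    ≈⟨ assoc _ _ _ ⟨
      (PA i j ∙ PA j j′) ∙ PA j′ j    ≈⟨ ∙-congʳ (pathMatrix-via-next A τ (next≢ ν i)) ⟨
      PA i j′ ∙ PA j′ j               ≈⟨ ∙-cong (P≈ i j′) (P≈ j′ j) ⟩
      PB i j′ ∙ PB j′ j               ≈⟨ pathMatrix-via-next B ν (next≢ τ i) ⟨
      PB i j                          ≈⟨ P≈ i j ⟨
      PA i j                          ∎)))
      where PA PB : Matrix (suc (suc k))
            PA = pathMatrix A τ
            PB = pathMatrix B ν
            j j′ : Fin (suc (suc k))
            j  = next τ i
            j′ = next ν i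

    pathMatrix≈⇒edge≈ : (∀ i → next τ i ≡ next ν i) → ∀ t → edge A τ t ≈ edge B τ t
    pathMatrix≈⇒edge≈ next≡ t = begin
      A x (τ ⟨$⟩ʳ sucMod t)         ≡⟨ cong (A x) (next-⟨$⟩ʳ τ t) ⟨
      A x (next τ x)                ≈⟨ pathMatrix-edge A τ x (next≢ τ x) ⟨
      pathMatrix A τ x (next τ x)   ≈⟨ P≈ x (next τ x) ⟩
      pathMatrix B ν x (next τ x)   ≡⟨ cong (pathMatrix B ν x) (next≡ x) ⟩
      pathMatrix B ν x (next ν x)   ≈⟨ pathMatrix-edge B ν x (next≢ ν x) ⟩
      B x (next ν x)                ≡⟨ cong (B x) (trans (sym (next≡ x)) (next-⟨$⟩ʳ τ t)) ⟩
      B x (τ ⟨$⟩ʳ sucMod t)         ∎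
      where x : Fin (suc (suc k))
            x = τ ⟨$⟩ʳ t

    pathMatrix≈⇒cycVal≈ : cycVal A τ ≈ cycVal B ν
    pathMatrix≈⇒cycVal≈ = begin
      cycVal A τ                                              ≈⟨ pathMatrix-cycle A τ 0≢1 ⟨
      pathMatrix A τ 0F 1F ∙ pathMatrix A τ 1F 0F             ≈⟨ ∙-cong (P≈ 0F 1F) (P≈ 1F 0F) ⟩
      pathMatrix B ν 0F 1F ∙ pathMatrix B ν 1F 0F             ≈⟨ pathMatrix-cycle B ν 0≢1 ⟩
      cycVal B ν                                              ∎
      where 0F 1F : Fin (suc (suc k))
            0F = Fin.zero
            1F = Fin.suc Fin.zero
            0≢1 : 0F ≢ 1F
            0≢1 ()

theorem3p4 : ∀ {c ℓ₁ ℓ₂} (G : OrderedAbelianGroup c ℓ₁ ℓ₂) →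
    let open OrderedAbelianGroup G
        open PC G
    in ∀ (n : ℕ) → 3 ≤ n → (A B : Matrix n) (τ ν : HSeq n) →
       InPC⁰ A → InPC⁰ B → InΓ A τ → InΓ B ν →
       (∀ i j → pathMatrix A τ i j ≈ pathMatrix B ν i j) →
       SameHCycle τ ν × (∀ t → edge A τ t ≈ edge B τ t) × (cycVal A τ ≈ cycVal B ν)
theorem3p4 G (suc (suc (suc k))) (s≤s (s≤s (s≤s z≤n))) A B τ ν _ _ τ∈ΓA _ P≈ =
  next≡⇒SameHCycle τ ν next≡ , pathMatrix≈⇒edge≈ G A B τ ν P≈ next≡ , pathMatrix≈⇒cycVal≈ G A B τ ν P≈
  where
  open OrderedAbelianGroup G using (isStrictTotalOrder)
  next≡ : ∀ i → next τ i ≡ next ν i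
  next≡ = pathMatrix≈⇒next≡ G A B τ ν P≈ (λ cyc≈ε → IsStrictTotalOrder.irrefl isStrictTotalOrder cyc≈ε τ∈ΓA)
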